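{- Let $G=(V,E)$ be a finite, simple, undirected graph, and for $v\in V$ let $N(v)$ denote the open neighborhood of $v$. Consider the integer linear program \[ \min \sum_{v\in V} p_v + \sum_{v\in V} q_v + \sum_{v\in V} r_v \] subject to, for every $v\in V$: \[ p_v+\tfrac12\sum_{u\in N(v)} q_u+\tfrac12\sum_{u\in N(v)} r_u\ \ge 1,\qquad q_v+\sum_{u\in N(v)} q_u\ \ge p_v,\qquad r_v\le q_v\le p_v,\qquad p_v,q_v,r_v\in\{0,1\}. \] Then the optimal objective value of this program equals the double Roman domination number $\gamma_{dR}(G)$.
   Context: A double Roman dominating function (DRDF) on a graph $G=(V,E)$ is a function $f:V\to\{0,1,2,3\}$ such that: if $f(v)=0$ then $v$ has at least two neighbors $u$ with $f(u)=2$ or at least one neighbor $u$ with $f(u)=3$; and if $f(v)=1$ then $v$ has at least one neighbor $u$ with $f(u)\ge 2$. The weight of $f$ is $\sum_{v\in V} f(v)$, and the double Roman domination number $\gamma_{dR}(G)$ is the minimum weight of a DRDF on $G$. -}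

module Defs where

open import Data.Nat using (ℕ; zero; suc; _+_; _*_; _≤_)
open import Data.Fin using (Fin; zero; suc)
open import Data.Bool using (Bool; true; false; if_then_else_)
open import Data.Product using (Σ; _×_; ∃; ∃-syntax; _,_)
open import Data.Sum using (_⊎_)
open import Relation.Binary.PropositionalEquality using (_≡_; _≢_)

record Graph (n : ℕ) : Set where
  field
    adj     : Fin n → Fin n → Bool
    sym     : ∀ u v → adj u v ≡ adj v u
    irrefl  : ∀ v → adj v v ≡ false
open Graph public

sumFin : ∀ {n} → (Fin n → ℕ) → ℕ
sumFin {zero}  f = 0
sumFin {suc n} f = f zero + sumFin (λ i → f (suc i))

sumN : ∀ {n} → Graph n → Fin n → (Fin n → ℕ) → ℕ
sumN G v f = sumFin (λ u → if adj G v u then f u else 0)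

Adj : ∀ {n} → Graph n → Fin n → Fin n → Set
Adj G v u = adj G v u ≡ true

record IsDRDF {n} (G : Graph n) (f : Fin n → ℕ) : Set where
  field
    range : ∀ v → f v ≤ 3
    zero-cond : ∀ v → f v ≡ 0 →
      (∃[ u ] ∃[ w ] (u ≢ w × Adj G v u × Adj G v w × f u ≡ 2 × f w ≡ 2))
      ⊎ (∃[ u ] (Adj G v u × f u ≡ 3))
    one-cond : ∀ v → f v ≡ 1 → ∃[ u ] (Adj G v u × 2 ≤ f u)

weight : ∀ {n} → (Fin n → ℕ) → ℕ
weight f = sumFin f

IsMin : (ℕ → Set) → ℕ → Set
IsMin P m = P m × (∀ k → P k → m ≤ k)

DRDFWeight : ∀ {n} → Graph n → ℕ → Set
DRDFWeight G k = Σ (_ → ℕ) λ f → IsDRDF G f × weight f ≡ k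

IsDoubleRomanDominationNumber : ∀ {n} → Graph n → ℕ → Set
IsDoubleRomanDominationNumber G = IsMin (DRDFWeight G)

-- Feasible solutions of the ILP. The first constraint
--   p_v + 1/2 Σ_{N(v)} q_u + 1/2 Σ_{N(v)} r_u ≥ 1
-- is written multiplied by 2.
record ILPFeasible {n} (G : Graph n) (p q r : Fin n → ℕ) : Set where
  field
    p01 : ∀ v → p v ≤ 1
    q01 : ∀ v → q v ≤ 1
    r01 : ∀ v → r v ≤ 1
    c1  : ∀ v → 2 ≤ 2 * p v + sumN G v q + sumN G v r
    c2  : ∀ v → p v ≤ q v + sumN G v q
    c3  : ∀ v → r v ≤ q v
    c4  : ∀ v → q v ≤ p v

ILPValue : ∀ {n} → Graph n → ℕ → Set
ILPValue G k = Σ (_ → ℕ) λ p → Σ (_ → ℕ) λ q → Σ (_ → ℕ) λ r →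
  ILPFeasible G p q r × sumFin p + sumFin q + sumFin r ≡ k

IsILPOptimum : ∀ {n} → Graph n → ℕ → Set
IsILPOptimum G = IsMin (ILPValue G)

-- A feasible (p, q, r) is forced vertexwise into one of the staircases 000, 100, 110, 111,
-- so f = p + q + r takes values in {0,1,2,3}, and the two covering constraints say exactly
-- that f is double Roman dominating.  Conversely a DRDF f yields the feasible solution
-- p = [f ≥ 1], q = [f ≥ 2], r = [f ≥ 3] of the same objective value.  Both optimisation
-- problems thus have the same attainable values; the ILP has only finitely many 0/1
-- solutions, so a least attainable value exists constructively.
module Submission where

open import Defs hiding (sym)
open import Data.Bool using (true; false; if_then_else_)
open import Data.Empty using (⊥-elim)
open import Data.Fin using (Fin; zero; suc)
open import Data.Fin.Properties using (all?; suc-injective)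
open import Data.Fin.Subset using (Subset)
open import Data.Fin.Subset.Properties using (anySubset?)
open import Data.Nat using (ℕ; zero; suc; _+_; _*_; _≤_; _<_; _≤ᵇ_; z≤n; s≤s; s≤s⁻¹; _≤?_; _≟_)
open import Data.Nat.Properties hiding (suc-injective)
open import Algebra.Properties.CommutativeSemigroup +-commutativeSemigroup using (interchange)
open import Data.Product using (Σ; _×_; ∃; ∃-syntax; _,_; proj₁; proj₂)
open import Data.Sum using (_⊎_; inj₁; inj₂)
open import Data.Vec using (lookup; tabulate)
open import Data.Vec.Properties using (lookup∘tabulate)
open import Function.Bundles using (_⇔_; mk⇔; Equivalence)
open import Function.Properties.Equivalence using () renaming (sym to ⇔-sym; trans to ⇔-trans)
open import Relation.Nullary using (Dec; yes; no; ¬_)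
open import Relation.Nullary.Decidable using (map′; _×-dec_)
open import Relation.Unary using (Decidable)
open import Relation.Binary.PropositionalEquality

private
  variable
    n k : ℕ

sumFin-cong : {f g : Fin n → ℕ} → (∀ v → f v ≡ g v) → sumFin f ≡ sumFin g
sumFin-cong {zero}  f≗g = refl
sumFin-cong {suc n} f≗g = cong₂ _+_ (f≗g zero) (sumFin-cong (λ i → f≗g (suc i)))

sumFin-+ : (f g : Fin n → ℕ) → sumFin (λ v → f v + g v) ≡ sumFin f + sumFin g
sumFin-+ {zero}  f g = refl
sumFin-+ {suc n} f g = begin
  f zero + g zero + sumFin (λ i → f (suc i) + g (suc i))
    ≡⟨ cong (f zero + g zero +_) (sumFin-+ (λ i → f (suc i)) (λ i → g (suc i))) ⟩
  f zero + g zero + (sumFin (λ i → f (suc i)) + sumFin (λ i → g (suc i)))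
    ≡⟨ interchange (f zero) (g zero) _ _ ⟩
  sumFin f + sumFin g ∎
  where open ≡-Reasoning

sumFin-+₃ : (f g h : Fin n → ℕ) →
            sumFin (λ v → f v + g v + h v) ≡ sumFin f + sumFin g + sumFin h
sumFin-+₃ f g h =
  trans (sumFin-+ (λ v → f v + g v) h) (cong (_+ sumFin h) (sumFin-+ f g))

≤-sumFin : (h : Fin n → ℕ) (u : Fin n) → h u ≤ sumFin h
≤-sumFin h zero    = m≤m+n (h zero) _
≤-sumFin h (suc u) = ≤-trans (≤-sumFin (λ i → h (suc i)) u) (m≤n+m _ (h zero))

sumFin-≥2 : (h : Fin n → ℕ) {u w : Fin n} → u ≢ w → 1 ≤ h u → 1 ≤ h w → 2 ≤ sumFin h
sumFin-≥2 h {zero}  {zero}  u≢w _ _ = ⊥-elim (u≢w refl)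
sumFin-≥2 h {zero}  {suc w} _ hu hw = +-mono-≤ hu (≤-trans hw (≤-sumFin (λ i → h (suc i)) w))
sumFin-≥2 h {suc u} {zero}  _ hu hw =
  subst (2 ≤_) (+-comm _ (h zero)) (+-mono-≤ (≤-trans hu (≤-sumFin (λ i → h (suc i)) u)) hw)
sumFin-≥2 h {suc u} {suc w} u≢w hu hw =
  ≤-trans (sumFin-≥2 (λ i → h (suc i)) (λ u≡w → u≢w (cong suc u≡w)) hu hw) (m≤n+m _ (h zero))

sumFin-pos : (h : Fin n → ℕ) → 1 ≤ sumFin h → ∃[ u ] 1 ≤ h u
sumFin-pos {zero}  h ()
sumFin-pos {suc n} h pos with h zero in h₀≡
... | suc _ = zero , subst (1 ≤_) (sym h₀≡) (s≤s z≤n)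
... | zero with sumFin-pos (λ i → h (suc i)) pos
...   | u , hu = suc u , hu

sumFin-≥2-binary : (h : Fin n → ℕ) → (∀ u → h u ≤ 1) → 2 ≤ sumFin h →
                   ∃[ u ] ∃[ w ] (u ≢ w × 1 ≤ h u × 1 ≤ h w)
sumFin-≥2-binary {zero}  h _ ()
sumFin-≥2-binary {suc n} h h≤1 sum≥2 with h zero in h₀≡
... | suc (suc _) = ⊥-elim (<⇒≱ (s≤s (s≤s z≤n)) (subst (_≤ 1) h₀≡ (h≤1 zero)))
... | suc zero with sumFin-pos (λ i → h (suc i)) (s≤s⁻¹ sum≥2)
...   | u , hu = zero , suc u , (λ ()) , subst (1 ≤_) (sym h₀≡) (s≤s z≤n) , hu
sumFin-≥2-binary {suc n} h h≤1 sum≥2 | zero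
  with sumFin-≥2-binary (λ i → h (suc i)) (λ i → h≤1 (suc i)) sum≥2
... | u , w , u≢w , hu , hw = suc u , suc w , (λ su≡sw → u≢w (suc-injective su≡sw)) , hu , hw

module _ {n} (G : Graph n) where

  sumN-cong : ∀ v {f g : Fin n → ℕ} → (∀ u → f u ≡ g u) → sumN G v f ≡ sumN G v g
  sumN-cong v f≗g = sumFin-cong (λ u → cong (if adj G v u then_else 0) (f≗g u))

  masked-adj : ∀ {v u x} → Adj G v u → (if adj G v u then x else 0) ≡ x
  masked-adj v~u rewrite v~u = refl

  ≤-sumN : ∀ {v u} (g : Fin n → ℕ) → Adj G v u → g u ≤ sumN G v g
  ≤-sumN {u = u} g v~u = subst (_≤ sumN G _ g) (masked-adj v~u) (≤-sumFin _ u)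

  masked-pos : ∀ v u {x} → 1 ≤ (if adj G v u then x else 0) → Adj G v u × 1 ≤ x
  masked-pos v u pos with adj G v u
  ... | true  = refl , pos
  ... | false = ⊥-elim (<⇒≱ pos z≤n)

  masked-≤1 : ∀ v u {x} → x ≤ 1 → (if adj G v u then x else 0) ≤ 1
  masked-≤1 v u x≤1 with adj G v u
  ... | true  = x≤1
  ... | false = z≤n

  sumN-≥2 : ∀ {v u w} (g : Fin n → ℕ) → u ≢ w → Adj G v u → Adj G v w →
            1 ≤ g u → 1 ≤ g w → 2 ≤ sumN G v g
  sumN-≥2 g u≢w v~u v~w gu gw = sumFin-≥2 _ u≢w
    (subst (1 ≤_) (sym (masked-adj v~u)) gu) (subst (1 ≤_) (sym (masked-adj v~w)) gw)

  sumN-pos : ∀ v (g : Fin n → ℕ) → 1 ≤ sumN G v g → ∃[ u ] (Adj G v u × 1 ≤ g u)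
  sumN-pos v g pos with sumFin-pos _ pos
  ... | u , term-pos = u , masked-pos v u term-pos

  sumN-≥2-binary : ∀ v (g : Fin n → ℕ) → (∀ u → g u ≤ 1) → 2 ≤ sumN G v g →
                   ∃[ u ] ∃[ w ] (u ≢ w × Adj G v u × Adj G v w × 1 ≤ g u × 1 ≤ g w)
  sumN-≥2-binary v g g≤1 sum≥2
    with sumFin-≥2-binary _ (λ u → masked-≤1 v u (g≤1 u)) sum≥2
  ... | u , w , u≢w , u-pos , w-pos with masked-pos v u u-pos | masked-pos v w w-pos
  ...   | v~u , gu | v~w , gw = u , w , u≢w , v~u , v~w , gu , gw

-- From feasible ILP solutions to DRDFs

data Staircase : ℕ → ℕ → ℕ → Set where
  s000 : Staircase 0 0 0
  s100 : Staircase 1 0 0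
  s110 : Staircase 1 1 0
  s111 : Staircase 1 1 1

staircase : ∀ {p q r} → p ≤ 1 → q ≤ 1 → r ≤ 1 → r ≤ q → q ≤ p → Staircase p q r
staircase z≤n             z≤n             z≤n             _  _  = s000
staircase (s≤s z≤n)       z≤n             z≤n             _  _  = s100
staircase (s≤s z≤n)       (s≤s z≤n)       z≤n             _  _  = s110
staircase (s≤s z≤n)       (s≤s z≤n)       (s≤s z≤n)       _  _  = s111
staircase _               z≤n             (s≤s z≤n)       () _
staircase z≤n             (s≤s z≤n)       _               _  ()

Staircase-sum≤3 : ∀ {p q r} → Staircase p q r → p + q + r ≤ 3
Staircase-sum≤3 s000 = z≤n
Staircase-sum≤3 s100 = s≤s z≤n
Staircase-sum≤3 s110 = s≤s (s≤s z≤n)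
Staircase-sum≤3 s111 = ≤-refl

Staircase-r-pos : ∀ {p q r} → Staircase p q r → 1 ≤ r → p + q + r ≡ 3
Staircase-r-pos s111 _ = refl

Staircase-q-pos : ∀ {p q r} → Staircase p q r → 1 ≤ q → p + q + r ≡ 2 ⊎ p + q + r ≡ 3
Staircase-q-pos s110 _ = inj₁ refl
Staircase-q-pos s111 _ = inj₂ refl

Staircase-q-pos⇒2≤ : ∀ {p q r} → Staircase p q r → 1 ≤ q → 2 ≤ p + q + r
Staircase-q-pos⇒2≤ s110 _ = ≤-refl
Staircase-q-pos⇒2≤ s111 _ = s≤s (s≤s z≤n)

Staircase-sum≡1 : ∀ {p q r} → Staircase p q r → p + q + r ≡ 1 → p ≡ 1 × q ≡ 0
Staircase-sum≡1 s100 _ = refl , refl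

feasible⇒DRDF : ∀ {G : Graph n} {p q r} → ILPFeasible G p q r →
                IsDRDF G (λ v → p v + q v + r v)
feasible⇒DRDF {G = G} {p} {q} {r} F = record
  { range     = λ v → Staircase-sum≤3 (stair v)
  ; zero-cond = zero-cond
  ; one-cond  = one-cond
  }
  where
  open ILPFeasible F

  f : _ → ℕ
  f v = p v + q v + r v

  stair : ∀ v → Staircase (p v) (q v) (r v)
  stair v = staircase (p01 v) (q01 v) (r01 v) (c3 v) (c4 v)

  q-sum≥2 : ∀ v → f v ≡ 0 → ¬ 1 ≤ sumN G v r → 2 ≤ sumN G v q
  q-sum≥2 v fv≡0 ¬r-pos = begin
    2                                  ≤⟨ c1 v ⟩
    2 * p v + sumN G v q + sumN G v r  ≡⟨ cong₂ (λ a b → 2 * a + sumN G v q + b) pv≡0 r-sum≡0 ⟩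
    sumN G v q + 0                     ≡⟨ +-identityʳ _ ⟩
    sumN G v q                         ∎
    where
    open ≤-Reasoning
    pv≡0 : p v ≡ 0
    pv≡0 = m+n≡0⇒m≡0 (p v) (m+n≡0⇒m≡0 (p v + q v) fv≡0)
    r-sum≡0 : sumN G v r ≡ 0
    r-sum≡0 = n<1⇒n≡0 (≰⇒> ¬r-pos)

  zero-cond : ∀ v → f v ≡ 0 →
    (∃[ u ] ∃[ w ] (u ≢ w × Adj G v u × Adj G v w × f u ≡ 2 × f w ≡ 2))
    ⊎ (∃[ u ] (Adj G v u × f u ≡ 3))
  zero-cond v fv≡0 with 1 ≤? sumN G v r
  ... | yes r-pos with sumN-pos G v r r-pos
  ...   | u , v~u , ru = inj₂ (u , v~u , Staircase-r-pos (stair u) ru)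
  zero-cond v fv≡0 | no ¬r-pos with sumN-≥2-binary G v q q01 (q-sum≥2 v fv≡0 ¬r-pos)
  ... | u , w , u≢w , v~u , v~w , qu , qw
    with Staircase-q-pos (stair u) qu | Staircase-q-pos (stair w) qw
  ...   | inj₁ fu≡2 | inj₁ fw≡2 = inj₁ (u , w , u≢w , v~u , v~w , fu≡2 , fw≡2)
  ...   | inj₂ fu≡3 | _         = inj₂ (u , v~u , fu≡3)
  ...   | inj₁ _    | inj₂ fw≡3 = inj₂ (w , v~w , fw≡3)

  one-cond : ∀ v → f v ≡ 1 → ∃[ u ] (Adj G v u × 2 ≤ f u)
  one-cond v fv≡1 with Staircase-sum≡1 (stair v) fv≡1
  ... | pv≡1 , qv≡0 with sumN-pos G v q (subst₂ (λ a b → a ≤ b + sumN G v q) pv≡1 qv≡0 (c2 v))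
  ...   | u , v~u , qu = u , v~u , Staircase-q-pos⇒2≤ (stair u) qu

-- From DRDFs to feasible ILP solutions

atLeast : ℕ → ℕ → ℕ
atLeast zero    _       = 1
atLeast (suc k) zero    = 0
atLeast (suc k) (suc x) = atLeast k x

atLeast≤1 : ∀ k x → atLeast k x ≤ 1
atLeast≤1 zero    _       = ≤-refl
atLeast≤1 (suc k) zero    = z≤n
atLeast≤1 (suc k) (suc x) = atLeast≤1 k x

atLeast-antitone : ∀ k x → atLeast (suc k) x ≤ atLeast k x
atLeast-antitone zero    x       = atLeast≤1 1 x
atLeast-antitone (suc k) zero    = z≤n
atLeast-antitone (suc k) (suc x) = atLeast-antitone k x

atLeast-pos : ∀ {k x} → k ≤ x → 1 ≤ atLeast k x
atLeast-pos z≤n       = ≤-refl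
atLeast-pos (s≤s k≤x) = atLeast-pos k≤x

atLeast-sum : ∀ x → x ≤ 3 → atLeast 1 x + atLeast 2 x + atLeast 3 x ≡ x
atLeast-sum 0 _ = refl
atLeast-sum 1 _ = refl
atLeast-sum 2 _ = refl
atLeast-sum 3 _ = refl
atLeast-sum (suc (suc (suc (suc _)))) (s≤s (s≤s (s≤s ())))

DRDF⇒feasible : ∀ {G : Graph n} {f} → IsDRDF G f →
                ILPFeasible G (λ v → atLeast 1 (f v)) (λ v → atLeast 2 (f v)) (λ v → atLeast 3 (f v))
DRDF⇒feasible {G = G} {f} D = record
  { p01 = λ v → atLeast≤1 1 (f v)
  ; q01 = λ v → atLeast≤1 2 (f v)
  ; r01 = λ v → atLeast≤1 3 (f v)
  ; c1  = c1
  ; c2  = c2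
  ; c3  = λ v → atLeast-antitone 2 (f v)
  ; c4  = λ v → atLeast-antitone 1 (f v)
  }
  where
  open IsDRDF D

  q r : _ → ℕ
  q v = atLeast 2 (f v)
  r v = atLeast 3 (f v)

  c1 : ∀ v → 2 ≤ 2 * atLeast 1 (f v) + sumN G v q + sumN G v r
  c1 v with f v in fv≡
  ... | suc _ = ≤-trans (m≤m+n 2 (sumN G v q)) (m≤m+n _ (sumN G v r))
  ... | zero with zero-cond v fv≡
  ...   | inj₁ (u , w , u≢w , v~u , v~w , fu≡2 , fw≡2) =
    ≤-trans (sumN-≥2 G q u≢w v~u v~w (atLeast-pos (≤-reflexive (sym fu≡2)))
                                     (atLeast-pos (≤-reflexive (sym fw≡2))))
            (m≤m+n (sumN G v q) (sumN G v r))
  ...   | inj₂ (u , v~u , fu≡3) =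
    +-mono-≤ (≤-trans (atLeast-pos (≤-trans (n≤1+n 2) (≤-reflexive (sym fu≡3)))) (≤-sumN G q v~u))
             (≤-trans (atLeast-pos (≤-reflexive (sym fu≡3))) (≤-sumN G r v~u))

  c2 : ∀ v → atLeast 1 (f v) ≤ q v + sumN G v q
  c2 v with f v in fv≡
  ... | zero        = z≤n
  ... | suc (suc _) = m≤m+n 1 (sumN G v q)
  ... | suc zero with one-cond v fv≡
  ...   | u , v~u , 2≤fu = ≤-trans (atLeast-pos 2≤fu) (≤-sumN G q v~u)

Solution : Graph n → ℕ → (p q r : Fin n → ℕ) → Set
Solution G k p q r = ILPFeasible G p q r × sumFin p + sumFin q + sumFin r ≡ k

ILPValue⇔DRDFWeight : (G : Graph n) → ∀ k → ILPValue G k ⇔ DRDFWeight G k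
ILPValue⇔DRDFWeight G k = mk⇔ ILP⇒DRDF DRDF⇒ILP
  where
  ILP⇒DRDF : ILPValue G k → DRDFWeight G k
  ILP⇒DRDF (p , q , r , F , obj≡k) = _ , feasible⇒DRDF F , trans (sumFin-+₃ p q r) obj≡k

  DRDF⇒ILP : DRDFWeight G k → ILPValue G k
  DRDF⇒ILP (f , D , wf≡k) = _ , _ , _ , DRDF⇒feasible D , (begin
    sumFin p + sumFin q + sumFin r    ≡⟨ sumFin-+₃ p q r ⟨
    sumFin (λ v → p v + q v + r v)   ≡⟨ sumFin-cong (λ v → atLeast-sum (f v) (IsDRDF.range D v)) ⟩
    weight f                          ≡⟨ wf≡k ⟩
    k                                 ∎)
    where
    open ≡-Reasoning
    p q r : _ → ℕ
    p v = atLeast 1 (f v)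
    q v = atLeast 2 (f v)
    r v = atLeast 3 (f v)

-- Finiteness of the ILP

indicator : Subset n → Fin n → ℕ
indicator X v = if lookup X v then 1 else 0

support : (Fin n → ℕ) → Subset n
support h = tabulate (λ v → 1 ≤ᵇ h v)

indicator-support : (h : Fin n → ℕ) → (∀ v → h v ≤ 1) → ∀ v → indicator (support h) v ≡ h v
indicator-support h h≤1 v rewrite lookup∘tabulate (λ u → 1 ≤ᵇ h u) v = binary (h≤1 v)
  where
  binary : ∀ {x} → x ≤ 1 → (if 1 ≤ᵇ x then 1 else 0) ≡ x
  binary z≤n       = refl
  binary (s≤s z≤n) = refl

ILPFeasible? : (G : Graph n) → ∀ p q r → Dec (ILPFeasible G p q r)
ILPFeasible? G p q r = map′
  (λ (a , b , c , d , e , f , g) →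
     record { p01 = a ; q01 = b ; r01 = c ; c1 = d ; c2 = e ; c3 = f ; c4 = g })
  (λ F → let open ILPFeasible F in p01 , q01 , r01 , c1 , c2 , c3 , c4)
  (all? (λ v → p v ≤? 1) ×-dec all? (λ v → q v ≤? 1) ×-dec all? (λ v → r v ≤? 1) ×-dec
   all? (λ v → 2 ≤? 2 * p v + sumN G v q + sumN G v r) ×-dec
   all? (λ v → p v ≤? q v + sumN G v q) ×-dec
   all? (λ v → r v ≤? q v) ×-dec all? (λ v → q v ≤? p v))

Solution-cong : ∀ {G : Graph n} {p q r p′ q′ r′} →
  (∀ v → p v ≡ p′ v) → (∀ v → q v ≡ q′ v) → (∀ v → r v ≡ r′ v) →
  Solution G k p q r → Solution G k p′ q′ r′
Solution-cong {G = G} p≗ q≗ r≗ (F , obj≡k) =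
  record
    { p01 = λ v → subst (_≤ 1) (p≗ v) (p01 v)
    ; q01 = λ v → subst (_≤ 1) (q≗ v) (q01 v)
    ; r01 = λ v → subst (_≤ 1) (r≗ v) (r01 v)
    ; c1  = λ v → subst (2 ≤_) (cong₂ _+_ (cong₂ _+_ (cong (2 *_) (p≗ v)) (sumN-cong G v q≗))
                                          (sumN-cong G v r≗)) (c1 v)
    ; c2  = λ v → subst₂ _≤_ (p≗ v) (cong₂ _+_ (q≗ v) (sumN-cong G v q≗)) (c2 v)
    ; c3  = λ v → subst₂ _≤_ (r≗ v) (q≗ v) (c3 v)
    ; c4  = λ v → subst₂ _≤_ (q≗ v) (p≗ v) (c4 v)
    } ,
  trans (sym (cong₂ _+_ (cong₂ _+_ (sumFin-cong p≗) (sumFin-cong q≗)) (sumFin-cong r≗))) obj≡k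
  where open ILPFeasible F

BinaryILPValue : Graph n → ℕ → Set
BinaryILPValue G k = ∃[ X ] ∃[ Y ] ∃[ Z ] Solution G k (indicator X) (indicator Y) (indicator Z)

BinaryILPValue? : (G : Graph n) → Decidable (BinaryILPValue G)
BinaryILPValue? G k = anySubset? λ X → anySubset? λ Y → anySubset? λ Z →
  ILPFeasible? G _ _ _ ×-dec (_ ≟ k)

ILPValue⇔BinaryILPValue : (G : Graph n) → ∀ k → ILPValue G k ⇔ BinaryILPValue G k
ILPValue⇔BinaryILPValue G k = mk⇔
  (λ { (p , q , r , S@(F , _)) → let open ILPFeasible F in
       support p , support q , support r ,
       Solution-cong (λ v → sym (indicator-support p p01 v)) (λ v → sym (indicator-support q q01 v))
                     (λ v → sym (indicator-support r r01 v)) S })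
  (λ { (X , Y , Z , S) → indicator X , indicator Y , indicator Z , S })

least-upTo : {P : ℕ → Set} → Decidable P → ∀ k → ∃ (IsMin P) ⊎ (∀ j → j ≤ k → ¬ P j)
least-upTo P? zero with P? zero
... | yes P0 = inj₁ (0 , P0 , λ _ _ → z≤n)
... | no ¬P0 = inj₂ λ { _ z≤n → ¬P0 }
least-upTo {P} P? (suc k) with least-upTo P? k
... | inj₁ least = inj₁ least
... | inj₂ none≤k with P? (suc k)
...   | yes Psk = inj₁ (suc k , Psk , λ j Pj → ≰⇒> (λ j≤k → none≤k j j≤k Pj))
...   | no ¬Psk = inj₂ λ j j≤sk → none≤sk j (m≤n⇒m<n∨m≡n j≤sk)
  where
  none≤sk : ∀ j → j < suc k ⊎ j ≡ suc k → ¬ P j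
  none≤sk j (inj₁ j<sk) = none≤k j (m<1+n⇒m≤n j<sk)
  none≤sk _ (inj₂ refl) = ¬Psk

least : {P : ℕ → Set} → Decidable P → P k → ∃ (IsMin P)
least {k} P? Pk with least-upTo P? k
... | inj₁ found = found
... | inj₂ none  = ⊥-elim (none k ≤-refl Pk)

IsMin-cong : {P Q : ℕ → Set} {m : ℕ} → (∀ k → P k ⇔ Q k) → IsMin P m → IsMin Q m
IsMin-cong {m = m} P⇔Q (Pm , m≤) =
  Equivalence.to (P⇔Q m) Pm , λ k Qk → m≤ k (Equivalence.from (P⇔Q k) Qk)

constant-two-DRDF : (G : Graph n) → DRDFWeight G (sumFin {n} (λ _ → 2))
constant-two-DRDF G =
  (λ _ → 2) , record { range = λ _ → s≤s (s≤s z≤n) ; zero-cond = λ _ () ; one-cond = λ _ () } , refl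

theorem2 : ∀ (n : ℕ) (G : Graph n) →
    Σ ℕ (λ m → IsILPOptimum G m × IsDoubleRomanDominationNumber G m)
theorem2 n G = m , IsMin-cong binary⇔ILP least-binary , IsMin-cong binary⇔DRDF least-binary
  where
  binary⇔ILP : ∀ k → BinaryILPValue G k ⇔ ILPValue G k
  binary⇔ILP k = ⇔-sym (ILPValue⇔BinaryILPValue G k)

  binary⇔DRDF : ∀ k → BinaryILPValue G k ⇔ DRDFWeight G k
  binary⇔DRDF k = ⇔-trans (binary⇔ILP k) (ILPValue⇔DRDFWeight G k)

  least-binary-value : ∃ (IsMin (BinaryILPValue G))
  least-binary-value =
    least (BinaryILPValue? G) (Equivalence.from (binary⇔DRDF _) (constant-two-DRDF G))

  m : ℕ
  m = proj₁ least-binary-value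

  least-binary : IsMin (BinaryILPValue G) m
  least-binary = proj₂ least-binary-value
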